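{- Let $\tau,\tau'$ be computable relational vocabularies containing $=$ and $\neq$, $\mathcal{K}\subseteq Mod(\tau)$, $\mathcal{K}'\subseteq Mod(\tau')$. From an index $e$ of a computable embedding $\Gamma_e$ of $\mathcal{K}$ into $\mathcal{K}'$ one can effectively obtain an index $a$ of an enumeration operator $\Gamma_a$ which maps every (atomic diagram of a) structure in $Mod(\tau)$ to (the atomic diagram of) a structure in $Mod(\tau')$ (so $\Gamma_a$ is an effective Scott continuous function $Mod(\tau)\to Mod(\tau')$), and such that $\Gamma_a(\mathcal{K})=\Gamma_e(\mathcal{K})$.
   Context: $Mod(\tau)$ is the set of $\tau$-structures with universe $\omega$, identified with atomic diagrams: the set of codes of atomic sentences (no negations) true under $x_i\mapsto i$ w.r.t. a fixed effective coding. An enumeration operator $\Gamma_e$ is the c.e. set $W_e$ of pairs $\langle v,m\rangle$, with $\Gamma_e(X)=\{m:\exists v(\langle v,m\rangle\in W_e\wedge D_v\subseteq X)\}$, $D_v$ the $v$th finite set in a fixed computable enumeration. $\Gamma_e$ is a computable embedding of $\mathcal{K}$ into $\mathcal{K}'$ if for every $\mathcal{A}\in\mathcal{K}$, $\Gamma_e(\mathcal{A})$ is the atomic diagram of a structure in $\mathcal{K}'$, and for $\mathcal{A},\mathcal{B}\in\mathcal{K}$, $\mathcal{A}\cong\mathcal{B}$ iff $\Gamma_e(\mathcal{A})\cong\Gamma_e(\mathcal{B})$. -}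

module Defs where

open import Level using (0ℓ)
open import Data.Nat using (ℕ; zero; suc; _+_; _<_; _≤_; _/_; _%_)
open import Data.Fin using (Fin)
open import Data.Vec using (Vec; []; _∷_; lookup; map)
open import Data.Maybe using (Maybe; just; nothing)
open import Data.Unit using (⊤)
open import Data.Product using (Σ; _×_; _,_)
open import Relation.Nullary using (¬_)
open import Relation.Binary.PropositionalEquality using (_≡_; subst; sym)
open import Function.Bundles using (_⇔_)

-- Model of computation: mu-recursive programs (an acceptable system of
-- indices).  Prog n = programs of arity n.

data Prog : ℕ → Set where
  zer  : ∀ {n} → Prog n
  succ : Prog 1
  proj : ∀ {n} → Fin n → Prog n
  comp : ∀ {n m} → Prog m → Vec (Prog n) m → Prog n
  prec : ∀ {n} → Prog n → Prog (suc (suc n)) → Prog (suc n)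
  mu   : ∀ {n} → Prog (suc n) → Prog n

mutual
  data _[_]⇓_ : ∀ {n} → Prog n → Vec ℕ n → ℕ → Set where
    ev-zer  : ∀ {n} {xs : Vec ℕ n} → zer [ xs ]⇓ 0
    ev-succ : ∀ {x} → succ [ x ∷ [] ]⇓ suc x
    ev-proj : ∀ {n} {i : Fin n} {xs} → proj i [ xs ]⇓ lookup xs i
    ev-comp : ∀ {n m} {f : Prog m} {gs : Vec (Prog n) m} {xs ys y} →
              gs [ xs ]⇓* ys → f [ ys ]⇓ y → comp f gs [ xs ]⇓ y
    ev-prec0 : ∀ {n} {f : Prog n} {g} {xs y} →
               f [ xs ]⇓ y → prec f g [ 0 ∷ xs ]⇓ y
    ev-precS : ∀ {n} {f : Prog n} {g} {xs k r y} →
               prec f g [ k ∷ xs ]⇓ r → g [ k ∷ r ∷ xs ]⇓ y →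
               prec f g [ suc k ∷ xs ]⇓ y
    ev-mu   : ∀ {n} {f : Prog (suc n)} {xs y} →
              f [ y ∷ xs ]⇓ 0 →
              (∀ z → z < y → Σ ℕ λ w → f [ z ∷ xs ]⇓ suc w) →
              mu f [ xs ]⇓ y

  data _[_]⇓*_ : ∀ {n m} → Vec (Prog n) m → Vec ℕ n → Vec ℕ m → Set where
    ev-nil  : ∀ {n} {xs : Vec ℕ n} → [] [ xs ]⇓* []
    ev-cons : ∀ {n m} {g : Prog n} {gs : Vec (Prog n) m} {xs y ys} →
              g [ xs ]⇓ y → gs [ xs ]⇓* ys → (g ∷ gs) [ xs ]⇓* (y ∷ ys)

W : Prog 1 → ℕ → Set
W e x = Σ ℕ λ y → e [ x ∷ [] ]⇓ y

SetN : Set₁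
SetN = ℕ → Set

_≐_ : SetN → SetN → Set
X ≐ Y = ∀ n → X n ⇔ Y n

-- Cantor pairing  ⟨x , y⟩ = (x+y)(x+y+1)/2 + y
tri : ℕ → ℕ
tri zero    = 0
tri (suc n) = suc n + tri n

pair : ℕ → ℕ → ℕ
pair x y = tri (x + y) + y

-- canonical index of finite sets: n ∈ D_v iff the n-th binary digit of v is 1
_∈D_ : ℕ → ℕ → Set
zero  ∈D v = v % 2 ≡ 1
suc n ∈D v = n ∈D (v / 2)

Γ : Prog 1 → SetN → SetN
Γ e X m = Σ ℕ λ v → W e (pair v m) × (∀ n → n ∈D v → X n)

-- symbols are 0,…,k-1 (bound = just k) or all of ℕ (bound = nothing)
ValidB : Maybe ℕ → ℕ → Set
ValidB nothing  i = ⊤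
ValidB (just k) i = i < k

record Vocab : Set where
  field
    bound     : Maybe ℕ
    arity     : ℕ → ℕ
    arityProg : Prog 1
    arityComp : ∀ i → arityProg [ i ∷ [] ]⇓ arity i
    eqValid   : ValidB bound 0
    neqValid  : ValidB bound 1
    eqArity   : arity 0 ≡ 2
    neqArity  : arity 1 ≡ 2
open Vocab public

Valid : Vocab → ℕ → Set
Valid τ i = ValidB (bound τ) i

encVec : ∀ {k} → Vec ℕ k → ℕ
encVec []       = 0
encVec (x ∷ xs) = suc (pair x (encVec xs))

atom : (τ : Vocab) → (i : ℕ) → Vec ℕ (arity τ i) → ℕ
atom τ i js = pair i (encVec js)

binTuple : (τ : Vocab) → (i : ℕ) → arity τ i ≡ 2 → ℕ → ℕ → Vec ℕ (arity τ i)
binTuple τ i p x y = subst (Vec ℕ) (sym p) (x ∷ y ∷ [])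

-- τ-structures with universe ω, = and ≠ interpreted standardly
record Structure (τ : Vocab) : Set₁ where
  field
    R     : (i : ℕ) → Vec ℕ (arity τ i) → Set
    R-eq  : ∀ x y → R 0 (binTuple τ 0 (eqArity τ) x y) ⇔ (x ≡ y)
    R-neq : ∀ x y → R 1 (binTuple τ 1 (neqArity τ) x y) ⇔ (¬ x ≡ y)
open Structure public

Diag : {τ : Vocab} → Structure τ → SetN
Diag {τ} S n = Σ ℕ λ i → Valid τ i × Σ (Vec ℕ (arity τ i)) λ js →
                 (n ≡ atom τ i js) × R S i js

Mod : Vocab → SetN → Set₁
Mod τ X = Σ (Structure τ) λ S → X ≐ Diag S

Iso : Vocab → SetN → SetN → Set
Iso τ X Y = Σ (ℕ → ℕ) λ f → Σ (ℕ → ℕ) λ g →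
              (∀ n → g (f n) ≡ n) × (∀ n → f (g n) ≡ n) ×
              (∀ i → Valid τ i → ∀ (js : Vec ℕ (arity τ i)) →
                 X (atom τ i js) ⇔ Y (atom τ i (map f js)))

Class : Set₂
Class = SetN → Set₁

_⊆Mod_ : Class → Vocab → Set₁
K ⊆Mod τ = ∀ X → K X → Mod τ X

IsCompEmb : Vocab → Vocab → Class → Class → Prog 1 → Set₁
IsCompEmb τ τ' K K' e =
  (∀ X → K X → Σ SetN λ Y → K' Y × (Γ e X ≐ Y)) ×
  (∀ X Y → K X → K Y → (Iso τ X Y ⇔ Iso τ' (Γ e X) (Γ e Y)))

-- Γ_a(K) = Γ_e(K)  (equality of the image classes, up to extensional set equality)
SameImage : Class → Prog 1 → Prog 1 → Set₁
SameImage K a e =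
  (∀ X → K X → Σ SetN λ Y → K Y × (Γ a X ≐ Γ e Y)) ×
  (∀ Y → K Y → Σ SetN λ X → K X × (Γ a X ≐ Γ e Y))

-- Let a be the operator that enumerates, for every X, the codes of all atoms x = x and x ≠ y
-- (attached to the empty finite set D_0), together with every output of Γ_e(X) that codes an
-- atom R_i(x̄) with i ≥ 2 a symbol of τ' applied to a tuple of the right arity.  Both parts are
-- decidable properties of the code, so W_a is c.e. uniformly in e.  Then Γ_a(X) is always an
-- atomic diagram, and if Γ_e(X) already is one, Γ_a(X) = Γ_e(X): its = and ≠ atoms are exactly
-- the ones a adds, and all its other elements pass the filter.  Since Γ_e maps K into K' ⊆ Mod(τ'),
-- Γ_a agrees with Γ_e on K.
module Submission where

open import Defs
open import Data.Bool using (Bool; true; false; T; not; _∧_; _∨_)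
open import Data.Bool.Properties using (T-∧; T-∨; T-≡; not-involutive)
open import Data.Empty using (⊥-elim)
open import Data.Fin using (Fin) renaming (zero to #0; suc to #suc)
open import Data.Maybe using (Maybe; just; nothing)
open import Data.Nat
open import Data.Nat.GeneralisedArithmetic using (fold; iterate; iterate-is-fold; +-is-fold)
open import Data.Nat.Properties
open import Data.Product using (Σ; _×_; _,_; proj₁; proj₂)
import Data.Product
open import Data.Sum using (_⊎_; inj₁; inj₂; map₂)
open import Data.Unit using (tt)
open import Data.Vec using (Vec; []; _∷_; lookup)
open import Function.Base using (_∘_)
open import Function.Bundles using (_⇔_; mk⇔; Equivalence)
open import Function.Construct.Composition using (_⇔-∘_)
open import Relation.Binary.PropositionalEquality
open import Relation.Nullary using (¬_)

private
  variable
    n : ℕ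
    F G H : Vec ℕ n → ℕ
    P Q : Vec ℕ n → Bool

mutual
  ⇓-deterministic : ∀ {n} {p : Prog n} {xs y z} → p [ xs ]⇓ y → p [ xs ]⇓ z → y ≡ z
  ⇓-deterministic ev-zer ev-zer = refl
  ⇓-deterministic ev-succ ev-succ = refl
  ⇓-deterministic ev-proj ev-proj = refl
  ⇓-deterministic (ev-comp ds d) (ev-comp ds′ d′) with ⇓*-deterministic ds ds′
  ... | refl = ⇓-deterministic d d′
  ⇓-deterministic (ev-prec0 d) (ev-prec0 d′) = ⇓-deterministic d d′
  ⇓-deterministic (ev-precS r d) (ev-precS r′ d′) with ⇓-deterministic r r′
  ... | refl = ⇓-deterministic d d′
  ⇓-deterministic (ev-mu d below) (ev-mu d′ below′) =
    ≤-antisym (≮⇒≥ (no-zero-below d′ below)) (≮⇒≥ (no-zero-below d below′))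

  no-zero-below : ∀ {n} {f : Prog (suc n)} {xs y z} → f [ y ∷ xs ]⇓ 0 →
                  (∀ w → w < z → Σ ℕ λ v → f [ w ∷ xs ]⇓ suc v) → y ≮ z
  no-zero-below d below y<z with below _ y<z
  ... | _ , d′ with ⇓-deterministic d d′
  ...   | ()

  ⇓*-deterministic : ∀ {n m} {ps : Vec (Prog n) m} {xs ys zs} →
                     ps [ xs ]⇓* ys → ps [ xs ]⇓* zs → ys ≡ zs
  ⇓*-deterministic ev-nil ev-nil = refl
  ⇓*-deterministic (ev-cons d ds) (ev-cons d′ ds′) =
    cong₂ _∷_ (⇓-deterministic d d′) (⇓*-deterministic ds ds′)

record Computable (n : ℕ) (F : Vec ℕ n → ℕ) : Set where
  field
    program  : Prog n
    computes : ∀ xs → program [ xs ]⇓ F xs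
open Computable public

Computable-resp : Computable n F → (∀ xs → F xs ≡ G xs) → Computable n G
Computable-resp c F≗G = record
  { program  = program c
  ; computes = λ xs → subst (program c [ xs ]⇓_) (F≗G xs) (computes c xs) }

constᶜ : ∀ k → Computable n (λ _ → k)
constᶜ zero    = record { program = zer ; computes = λ _ → ev-zer }
constᶜ (suc k) = record
  { program  = comp succ (program (constᶜ k) ∷ [])
  ; computes = λ xs → ev-comp (ev-cons (computes (constᶜ k) xs) ev-nil) ev-succ }

projᶜ : (i : Fin n) → Computable n (λ xs → lookup xs i)
projᶜ i = record { program = proj i ; computes = λ _ → ev-proj }

compose₁ : Computable 1 F → Computable n G → Computable n (λ xs → F (G xs ∷ []))
compose₁ f g = record
  { program  = comp (program f) (program g ∷ [])
  ; computes = λ xs → ev-comp (ev-cons (computes g xs) ev-nil) (computes f _) }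

compose₂ : Computable 2 F → Computable n G → Computable n H →
           Computable n (λ xs → F (G xs ∷ H xs ∷ []))
compose₂ f g h = record
  { program  = comp (program f) (program g ∷ program h ∷ [])
  ; computes = λ xs → ev-comp (ev-cons (computes g xs) (ev-cons (computes h xs) ev-nil))
                              (computes f _) }

primRec : (Vec ℕ n → ℕ) → (Vec ℕ (2 + n) → ℕ) → Vec ℕ (suc n) → ℕ
primRec F G (zero  ∷ xs) = F xs
primRec F G (suc k ∷ xs) = G (k ∷ primRec F G (k ∷ xs) ∷ xs)

primRecᶜ : Computable n F → Computable (2 + n) G → Computable (suc n) (primRec F G)
primRecᶜ {F = F} {G = G} f g = record { program = prec (program f) (program g) ; computes = run }
  where
  run : ∀ xs → prec (program f) (program g) [ xs ]⇓ primRec F G xs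
  run (zero  ∷ xs) = ev-prec0 (computes f xs)
  run (suc k ∷ xs) = ev-precS (run (k ∷ xs)) (computes g _)

sucᶜ : Computable n F → Computable n (λ xs → suc (F xs))
sucᶜ = compose₁ successor
  where
  successor : Computable 1 (λ xs → suc (lookup xs #0))
  successor = record { program = succ ; computes = λ { (x ∷ []) → ev-succ } }

foldᶜ : ∀ {s : ℕ → ℕ} → Computable 1 (λ xs → s (lookup xs #0)) →
        Computable n F → Computable n G → Computable n (λ xs → fold (G xs) s (F xs))
foldᶜ {s = s} step =
  compose₂ (Computable-resp (primRecᶜ (projᶜ #0) (compose₁ step (projᶜ (#suc #0)))) unfold)
  where
  unfold : ∀ xs → primRec (λ ys → lookup ys #0) (λ ys → s (lookup ys (#suc #0))) xs ≡
                  fold (lookup xs (#suc #0)) s (lookup xs #0)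
  unfold (zero  ∷ z ∷ []) = refl
  unfold (suc k ∷ z ∷ []) = cong s (unfold (k ∷ z ∷ []))

_+ᶜ_ : Computable n F → Computable n G → Computable n (λ xs → F xs + G xs)
_+ᶜ_ {F = F} f g = Computable-resp (foldᶜ (sucᶜ (projᶜ #0)) f g) (λ xs → +-is-fold (F xs))

predᶜ : Computable n F → Computable n (λ xs → pred (F xs))
predᶜ = compose₁ predecessor
  where
  predecessor : Computable 1 (λ xs → pred (lookup xs #0))
  predecessor = Computable-resp (primRecᶜ (constᶜ 0) (projᶜ #0))
                                λ { (zero ∷ []) → refl ; (suc _ ∷ []) → refl }

∸-is-fold : ∀ m n → fold m pred n ≡ m ∸ n
∸-is-fold m zero    = refl
∸-is-fold m (suc n) = trans (cong pred (∸-is-fold m n)) (pred[m∸n]≡m∸[1+n] m n)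

_∸ᶜ_ : Computable n F → Computable n G → Computable n (λ xs → F xs ∸ G xs)
_∸ᶜ_ {F = F} {G = G} f g =
  Computable-resp (foldᶜ (predᶜ (projᶜ #0)) g f) (λ xs → ∸-is-fold (F xs) (G xs))

T-not⇒¬T : ∀ {b} → T (not b) → ¬ T b
T-not⇒¬T {false} _ ()

¬T⇒T-not : ∀ {b} → ¬ T b → T (not b)
¬T⇒T-not {false} _   = tt
¬T⇒T-not {true}  ¬tt = ¬tt tt

bit : Bool → ℕ
bit false = 0
bit true  = 1

≡ᵇ-via-∸ : ∀ a b → 1 ∸ ((a ∸ b) + (b ∸ a)) ≡ bit (a ≡ᵇ b)
≡ᵇ-via-∸ zero    zero    = refl
≡ᵇ-via-∸ zero    (suc b) = 0∸n≡0 b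
≡ᵇ-via-∸ (suc a) zero    = 0∸n≡0 (a + 0)
≡ᵇ-via-∸ (suc a) (suc b) = ≡ᵇ-via-∸ a b

≤ᵇ-via-∸ : ∀ a b → 1 ∸ (a ∸ b) ≡ bit (a ≤ᵇ b)
≤ᵇ-via-∸ zero          b       = cong (1 ∸_) (0∸n≡0 b)
≤ᵇ-via-∸ (suc a)       zero    = 0∸n≡0 a
≤ᵇ-via-∸ (suc zero)    (suc b) = cong (1 ∸_) (0∸n≡0 b)
≤ᵇ-via-∸ (suc (suc a)) (suc b) = ≤ᵇ-via-∸ (suc a) b

_≡ᵇᶜ_ : Computable n F → Computable n G → Computable n (λ xs → bit (F xs ≡ᵇ G xs))
_≡ᵇᶜ_ {F = F} {G = G} f g =
  Computable-resp (constᶜ 1 ∸ᶜ ((f ∸ᶜ g) +ᶜ (g ∸ᶜ f))) (λ xs → ≡ᵇ-via-∸ (F xs) (G xs))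

_≤ᵇᶜ_ : Computable n F → Computable n G → Computable n (λ xs → bit (F xs ≤ᵇ G xs))
_≤ᵇᶜ_ {F = F} {G = G} f g =
  Computable-resp (constᶜ 1 ∸ᶜ (f ∸ᶜ g)) (λ xs → ≤ᵇ-via-∸ (F xs) (G xs))

notᶜ : Computable n (λ xs → bit (P xs)) → Computable n (λ xs → bit (not (P xs)))
notᶜ {P = P} p = Computable-resp (constᶜ 1 ∸ᶜ p) (λ xs → via-∸ (P xs))
  where
  via-∸ : ∀ a → 1 ∸ bit a ≡ bit (not a)
  via-∸ false = refl
  via-∸ true  = refl

_∧ᶜ_ : Computable n (λ xs → bit (P xs)) → Computable n (λ xs → bit (Q xs)) →
       Computable n (λ xs → bit (P xs ∧ Q xs))
_∧ᶜ_ {P = P} {Q = Q} p q = Computable-resp (p ∸ᶜ (constᶜ 1 ∸ᶜ q)) (λ xs → via-∸ (P xs) (Q xs))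
  where
  via-∸ : ∀ a b → bit a ∸ (1 ∸ bit b) ≡ bit (a ∧ b)
  via-∸ false b     = 0∸n≡0 (1 ∸ bit b)
  via-∸ true  false = refl
  via-∸ true  true  = refl

_∨ᶜ_ : Computable n (λ xs → bit (P xs)) → Computable n (λ xs → bit (Q xs)) →
       Computable n (λ xs → bit (P xs ∨ Q xs))
_∨ᶜ_ {P = P} {Q = Q} p q =
  Computable-resp (notᶜ (notᶜ p ∧ᶜ notᶜ q)) (λ xs → cong bit (de-morgan (P xs) (Q xs)))
  where
  de-morgan : ∀ a b → not (not a ∧ not b) ≡ a ∨ b
  de-morgan false b = not-involutive b
  de-morgan true  _ = refl

module _ (P : ℕ → Bool) (decide : Computable 1 (λ xs → bit (P (lookup xs #0)))) where

  private
    rejects : Computable 1 (λ xs → bit (not (P (lookup xs #0))))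
    rejects = notᶜ decide

    rejects₂ : Computable 2 (λ xs → bit (not (P (lookup xs (#suc #0)))))
    rejects₂ = compose₁ rejects (projᶜ (#suc #0))

  acceptor : Prog 1
  acceptor = mu (program rejects₂)

  W-acceptor : ∀ {x} → W acceptor x ⇔ T (P x)
  W-acceptor {x} = mk⇔ to from
    where
    to : W acceptor x → T (P x)
    to (y , ev-mu d _) with P x | computes rejects₂ (y ∷ x ∷ [])
    ... | true  | _ = tt
    ... | false | r with ⇓-deterministic d r
    ...   | ()
    from : T (P x) → W acceptor x
    from t with P x | computes rejects₂ (0 ∷ x ∷ [])
    ... | true | r = 0 , ev-mu r (λ _ ())

  -- Primitive recursion on the bit of ¬ P x is a lazy conditional:
  -- it halts at once on 0 and runs q on 1.
  acceptorOr : Prog 1 → Prog 1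
  acceptorOr q =
    comp (prec zer (comp q (proj (#suc (#suc #0)) ∷ []))) (program rejects ∷ proj #0 ∷ [])

  W-acceptorOr : ∀ {q x} → W (acceptorOr q) x ⇔ (T (P x) ⊎ W q x)
  W-acceptorOr {q} {x} = mk⇔ to from
    where
    to : W (acceptorOr q) x → T (P x) ⊎ W q x
    to (_ , ev-comp (ev-cons d (ev-cons ev-proj ev-nil)) run) with P x | computes rejects (x ∷ [])
    ... | true  | _ = inj₁ tt
    ... | false | r with ⇓-deterministic d r | run
    ...   | refl | ev-precS _ (ev-comp (ev-cons ev-proj ev-nil) dq) = inj₂ (_ , dq)
    from : T (P x) ⊎ W q x → W (acceptorOr q) x
    from h with P x | computes rejects (x ∷ [])
    ... | true  | r = 0 , ev-comp (ev-cons r (ev-cons ev-proj ev-nil)) (ev-prec0 ev-zer)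
    from (inj₂ (_ , dq)) | false | r =
      _ , ev-comp (ev-cons r (ev-cons ev-proj ev-nil))
                  (ev-precS (ev-prec0 ev-zer) (ev-comp (ev-cons ev-proj ev-nil) dq))

both : Prog 1 → Prog 1 → Prog 1
both p q = comp zer (p ∷ q ∷ [])

W-both : ∀ {p q x} → W (both p q) x ⇔ (W p x × W q x)
W-both = mk⇔ (λ { (_ , ev-comp (ev-cons dp (ev-cons dq ev-nil)) _) → (_ , dp) , (_ , dq) })
             (λ { ((_ , dp) , (_ , dq)) → 0 , ev-comp (ev-cons dp (ev-cons dq ev-nil)) ev-zer })

triᶜ : Computable n F → Computable n (λ xs → tri (F xs))
triᶜ = compose₁ triangle
  where
  triangle : Computable 1 (λ xs → tri (lookup xs #0))
  triangle = Computable-resp (primRecᶜ (constᶜ 0) (sucᶜ (projᶜ #0) +ᶜ projᶜ (#suc #0)))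
                             (λ { (k ∷ []) → unfold k })
    where
    unfold : ∀ k → primRec (λ _ → 0) (λ ys → suc (lookup ys #0) + lookup ys (#suc #0)) (k ∷ [])
                   ≡ tri k
    unfold zero    = refl
    unfold (suc k) = cong (suc k +_) (unfold k)

pairᶜ : Computable n F → Computable n G → Computable n (λ xs → pair (F xs) (G xs))
pairᶜ f g = triᶜ (f +ᶜ g) +ᶜ g

tri-mono-≤ : ∀ {s t} → s ≤ t → tri s ≤ tri t
tri-mono-≤ z≤n       = z≤n
tri-mono-≤ (s≤s s≤t) = +-mono-≤ (s≤s s≤t) (tri-mono-≤ s≤t)

triRoot : ℕ → ℕ
triRoot zero    = 0
triRoot (suc p) = bit (tri (suc (triRoot p)) ≤ᵇ suc p) + triRoot p

triRootᶜ : Computable n F → Computable n (λ xs → triRoot (F xs))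
triRootᶜ = compose₁ root
  where
  root : Computable 1 (λ xs → triRoot (lookup xs #0))
  root = Computable-resp
    (primRecᶜ (constᶜ 0) ((triᶜ (sucᶜ (projᶜ (#suc #0))) ≤ᵇᶜ sucᶜ (projᶜ #0)) +ᶜ projᶜ (#suc #0)))
    (λ { (p ∷ []) → unfold p })
    where
    unfold : ∀ p → primRec (λ _ → 0)
                           (λ ys → bit (tri (suc (lookup ys (#suc #0))) ≤ᵇ suc (lookup ys #0))
                                   + lookup ys (#suc #0))
                           (p ∷ []) ≡ triRoot p
    unfold zero    = refl
    unfold (suc p) rewrite unfold p = refl

triRoot-bounds : ∀ p → tri (triRoot p) ≤ p × p < tri (suc (triRoot p))
triRoot-bounds zero = z≤n , z<s
triRoot-bounds (suc p) with triRoot-bounds p | tri (suc (triRoot p)) ≤ᵇ suc p in step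
... | lo , hi | true  =
  ≤ᵇ⇒≤ _ _ (subst T (sym step) tt) , ≤-<-trans hi (m<n+m _ {2 + triRoot p} z<s)
... | lo , hi | false = m≤n⇒m≤1+n lo , ≰⇒> (λ le → subst T step (≤⇒≤ᵇ le))

tri-bracket-≤ : ∀ {s t p} → tri s ≤ p → p < tri (suc t) → s ≤ t
tri-bracket-≤ lo hi = ≮⇒≥ (λ t<s → <-irrefl refl (<-≤-trans hi (≤-trans (tri-mono-≤ t<s) lo)))

triRoot-unique : ∀ {s p} → tri s ≤ p → p < tri (suc s) → triRoot p ≡ s
triRoot-unique {s} {p} lo hi with triRoot-bounds p
... | lo′ , hi′ = ≤-antisym (tri-bracket-≤ lo′ hi) (tri-bracket-≤ lo hi′)

triRoot-pair : ∀ x y → triRoot (pair x y) ≡ x + y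
triRoot-pair x y = triRoot-unique (m≤m+n _ y) pair<
  where
  pair< : tri (x + y) + y < tri (suc (x + y))
  pair< = subst (tri (x + y) + y <_) (+-comm (tri (x + y)) (suc (x + y)))
                (+-monoʳ-< (tri (x + y)) (s≤s (m≤n+m y x)))

unpair₂ : ℕ → ℕ
unpair₂ p = p ∸ tri (triRoot p)

unpair₁ : ℕ → ℕ
unpair₁ p = triRoot p ∸ unpair₂ p

unpair₁ᶜ : Computable n F → Computable n (λ xs → unpair₁ (F xs))
unpair₁ᶜ f = triRootᶜ f ∸ᶜ (f ∸ᶜ triᶜ (triRootᶜ f))

unpair₂ᶜ : Computable n F → Computable n (λ xs → unpair₂ (F xs))
unpair₂ᶜ f = f ∸ᶜ triᶜ (triRootᶜ f)

unpair₂-pair : ∀ x y → unpair₂ (pair x y) ≡ y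
unpair₂-pair x y rewrite triRoot-pair x y = m+n∸m≡n (tri (x + y)) y

unpair₁-pair : ∀ x y → unpair₁ (pair x y) ≡ x
unpair₁-pair x y rewrite unpair₂-pair x y | triRoot-pair x y = m+n∸n≡m x y

pair-unpair : ∀ p → pair (unpair₁ p) (unpair₂ p) ≡ p
pair-unpair p with triRoot-bounds p
... | lo , hi = begin
  tri (triRoot p ∸ y + y) + y ≡⟨ cong (λ s → tri s + y) (m∸n+n≡m y≤s) ⟩
  tri (triRoot p) + y         ≡⟨ m+[n∸m]≡n lo ⟩
  p                           ∎
  where
  open ≡-Reasoning
  y : ℕ
  y = unpair₂ p
  y≤s : y ≤ triRoot p
  y≤s = s≤s⁻¹ (m<n+o⇒m∸n<o p (tri (triRoot p))
                 (subst (p <_) (+-comm (suc (triRoot p)) (tri (triRoot p))) hi))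

tupleHead : ℕ → ℕ
tupleHead c = unpair₁ (pred c)

tupleTail : ℕ → ℕ
tupleTail c = unpair₂ (pred c)

tupleHeadᶜ : Computable n F → Computable n (λ xs → tupleHead (F xs))
tupleHeadᶜ f = unpair₁ᶜ (predᶜ f)

tupleTailᶜ : Computable n F → Computable n (λ xs → tupleTail (F xs))
tupleTailᶜ f = unpair₂ᶜ (predᶜ f)

isTupleOfLength : ℕ → ℕ → Bool
isTupleOfLength zero    c       = c ≡ᵇ 0
isTupleOfLength (suc k) zero    = false
isTupleOfLength (suc k) (suc c) = isTupleOfLength k (unpair₂ c)

isTupleOfLength-sound : ∀ k c → T (isTupleOfLength k c) → Σ (Vec ℕ k) λ js → c ≡ encVec js
isTupleOfLength-sound zero    zero    _ = [] , refl
isTupleOfLength-sound (suc k) (suc c) t with isTupleOfLength-sound k (unpair₂ c) t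
... | js , c₂≡js =
  unpair₁ c ∷ js , cong suc (trans (sym (pair-unpair c)) (cong (pair (unpair₁ c)) c₂≡js))

isTupleOfLength-complete : ∀ {k} (js : Vec ℕ k) → T (isTupleOfLength k (encVec js))
isTupleOfLength-complete []       = tt
isTupleOfLength-complete (x ∷ js) rewrite unpair₂-pair x (encVec js) = isTupleOfLength-complete js

-- The state is 0 once the code has been rejected and suc c while the code c remains to be read,
-- so a code of a k-tuple is exactly one that reaches state 1 after k steps.
consume : ℕ → ℕ
consume zero          = 0
consume (suc zero)    = 0
consume (suc (suc c)) = suc (unpair₂ c)

iterate-consume-zero : ∀ k → iterate consume 0 k ≡ 0
iterate-consume-zero zero    = refl
iterate-consume-zero (suc k) = iterate-consume-zero k

isTupleOfLength-by-consume : ∀ k c → (iterate consume (suc c) k ≡ᵇ 1) ≡ isTupleOfLength k c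
isTupleOfLength-by-consume zero    c       = refl
isTupleOfLength-by-consume (suc k) zero    = cong (_≡ᵇ 1) (iterate-consume-zero k)
isTupleOfLength-by-consume (suc k) (suc c) = isTupleOfLength-by-consume k (unpair₂ c)

isTupleOfLengthᶜ : Computable n F → Computable n G →
                   Computable n (λ xs → bit (isTupleOfLength (F xs) (G xs)))
isTupleOfLengthᶜ {F = F} {G = G} f g =
  Computable-resp (foldᶜ consumeᶜ f (sucᶜ g) ≡ᵇᶜ constᶜ 1) λ xs →
    cong bit (trans (cong (_≡ᵇ 1) (iterate-is-fold (suc (G xs)) consume (F xs)))
                    (isTupleOfLength-by-consume (F xs) (G xs)))
  where
  u : Computable 1 (λ xs → lookup xs #0)
  u = projᶜ #0
  consumeᶜ : Computable 1 (λ xs → consume (lookup xs #0))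
  consumeᶜ = Computable-resp (sucᶜ (unpair₂ᶜ (u ∸ᶜ constᶜ 2)) ∸ᶜ (constᶜ 1 ∸ᶜ (u ∸ᶜ constᶜ 1)))
                             λ { (zero ∷ []) → refl ; (suc zero ∷ []) → refl
                               ; (suc (suc c) ∷ []) → cong (suc (unpair₂ c) ∸_) (0∸n≡0 c) }

binAtom : ℕ → ℕ → ℕ → ℕ
binAtom i x y = pair i (encVec (x ∷ y ∷ []))

binAtomᶜ : Computable n F → Computable n G → Computable n H →
           Computable n (λ xs → binAtom (F xs) (G xs) (H xs))
binAtomᶜ f g h = pairᶜ f (sucᶜ (pairᶜ g (sucᶜ (pairᶜ h (constᶜ 0)))))

atom-binTuple : ∀ τ i (ar : arity τ i ≡ 2) x y → atom τ i (binTuple τ i ar x y) ≡ binAtom i x y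
atom-binTuple τ i ar x y = cong (pair i) (encVec-subst (sym ar))
  where
  encVec-subst : ∀ {k} (eq : 2 ≡ k) → encVec (subst (Vec ℕ) eq (x ∷ y ∷ [])) ≡ encVec (x ∷ y ∷ [])
  encVec-subst refl = refl

binTuple-surjective : ∀ τ i (ar : arity τ i ≡ 2) (js : Vec ℕ (arity τ i)) →
                      Σ ℕ λ x → Σ ℕ λ y → js ≡ binTuple τ i ar x y
binTuple-surjective τ i ar = surjective ar
  where
  surjective : ∀ {k} (ar : k ≡ 2) (js : Vec ℕ k) →
               Σ ℕ λ x → Σ ℕ λ y → js ≡ subst (Vec ℕ) (sym ar) (x ∷ y ∷ [])
  surjective refl (x ∷ y ∷ []) = x , y , refl

binAtomSymbol binAtomArg₁ binAtomArg₂ : ℕ → ℕ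
binAtomSymbol m = unpair₁ m
binAtomArg₁   m = tupleHead (unpair₂ m)
binAtomArg₂   m = tupleHead (tupleTail (unpair₂ m))

binAtomSymbolᶜ : Computable n F → Computable n (λ xs → binAtomSymbol (F xs))
binAtomSymbolᶜ = unpair₁ᶜ

binAtomArg₁ᶜ : Computable n F → Computable n (λ xs → binAtomArg₁ (F xs))
binAtomArg₁ᶜ m = tupleHeadᶜ (unpair₂ᶜ m)

binAtomArg₂ᶜ : Computable n F → Computable n (λ xs → binAtomArg₂ (F xs))
binAtomArg₂ᶜ m = tupleHeadᶜ (tupleTailᶜ (unpair₂ᶜ m))

binAtom-decode : ∀ i x y → binAtomSymbol (binAtom i x y) ≡ i × binAtomArg₁ (binAtom i x y) ≡ x ×
                           binAtomArg₂ (binAtom i x y) ≡ y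
binAtom-decode i x y
  rewrite unpair₁-pair i (encVec (x ∷ y ∷ [])) | unpair₂-pair i (encVec (x ∷ y ∷ []))
        | unpair₁-pair x (encVec (y ∷ [])) | unpair₂-pair x (encVec (y ∷ []))
        | unpair₁-pair y 0 = refl , refl , refl

binAtom-injective : ∀ {i x y i′ x′ y′} → binAtom i x y ≡ binAtom i′ x′ y′ →
                    i ≡ i′ × x ≡ x′ × y ≡ y′
binAtom-injective {i} {x} {y} {i′} {x′} {y′} eq with binAtom-decode i x y | binAtom-decode i′ x′ y′
... | i≡ , x≡ , y≡ | i≡′ , x≡′ , y≡′ =
  trans (sym i≡) (trans (cong binAtomSymbol eq) i≡′) ,
  trans (sym x≡) (trans (cong binAtomArg₁ eq) x≡′) ,
  trans (sym y≡) (trans (cong binAtomArg₂ eq) y≡′)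

data TrivialAtom : ℕ → Set where
  eq-atom  : ∀ x → TrivialAtom (binAtom 0 x x)
  neq-atom : ∀ {x y} → x ≢ y → TrivialAtom (binAtom 1 x y)

TrivialAtom-inversion : ∀ {m i x y} → TrivialAtom m → m ≡ binAtom i x y →
                        (i ≡ 0 × x ≡ y) ⊎ (i ≡ 1 × x ≢ y)
TrivialAtom-inversion {i = i} {x} {y} (eq-atom z) eq
  with binAtom-injective {0} {z} {z} {i} {x} {y} eq
... | refl , refl , refl = inj₁ (refl , refl)
TrivialAtom-inversion {i = i} {x} {y} (neq-atom {z} {w} z≢w) eq
  with binAtom-injective {1} {z} {w} {i} {x} {y} eq
... | refl , refl , refl = inj₂ (refl , z≢w)

trivialPattern : ℕ → ℕ → ℕ → Bool
trivialPattern i x y = ((i ≡ᵇ 0) ∧ (x ≡ᵇ y)) ∨ ((i ≡ᵇ 1) ∧ not (x ≡ᵇ y))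

trivialPatternᶜ : Computable n F → Computable n G → Computable n H →
                  Computable n (λ xs → bit (trivialPattern (F xs) (G xs) (H xs)))
trivialPatternᶜ i x y = ((i ≡ᵇᶜ constᶜ 0) ∧ᶜ (x ≡ᵇᶜ y)) ∨ᶜ ((i ≡ᵇᶜ constᶜ 1) ∧ᶜ notᶜ (x ≡ᵇᶜ y))

trivialPattern-sound : ∀ i x y → T (trivialPattern i x y) → TrivialAtom (binAtom i x y)
trivialPattern-sound i x y t with Equivalence.to T-∨ t
... | inj₁ t₀ with Equivalence.to T-∧ t₀
...   | i≡ᵇ0 , x≡ᵇy = eq-case (≡ᵇ⇒≡ i 0 i≡ᵇ0) (≡ᵇ⇒≡ x y x≡ᵇy)
  where
  eq-case : i ≡ 0 → x ≡ y → TrivialAtom (binAtom i x y)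
  eq-case refl refl = eq-atom x
trivialPattern-sound i x y t | inj₂ t₁ with Equivalence.to T-∧ t₁
...   | i≡ᵇ1 , x≢ᵇy = neq-case (≡ᵇ⇒≡ i 1 i≡ᵇ1)
  where
  neq-case : i ≡ 1 → TrivialAtom (binAtom i x y)
  neq-case refl = neq-atom (λ x≡y → T-not⇒¬T x≢ᵇy (≡⇒≡ᵇ x y x≡y))

isTrivialAtom : ℕ → Bool
isTrivialAtom m = (m ≡ᵇ binAtom (binAtomSymbol m) (binAtomArg₁ m) (binAtomArg₂ m))
                ∧ trivialPattern (binAtomSymbol m) (binAtomArg₁ m) (binAtomArg₂ m)

isTrivialAtomᶜ : Computable n F → Computable n (λ xs → bit (isTrivialAtom (F xs)))
isTrivialAtomᶜ m = (m ≡ᵇᶜ binAtomᶜ (binAtomSymbolᶜ m) (binAtomArg₁ᶜ m) (binAtomArg₂ᶜ m))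
                ∧ᶜ trivialPatternᶜ (binAtomSymbolᶜ m) (binAtomArg₁ᶜ m) (binAtomArg₂ᶜ m)

isTrivialAtom-binAtom : ∀ i x y → isTrivialAtom (binAtom i x y) ≡ trivialPattern i x y
isTrivialAtom-binAtom i x y with binAtom-decode i x y
... | i≡ , x≡ , y≡ rewrite i≡ | x≡ | y≡ | Equivalence.to T-≡ (≡⇒≡ᵇ (binAtom i x y) _ refl) = refl

isTrivialAtom-sound : ∀ m → T (isTrivialAtom m) → TrivialAtom m
isTrivialAtom-sound m t with Equivalence.to T-∧ t
... | m≡ᵇ , shape =
  subst TrivialAtom (sym (≡ᵇ⇒≡ m _ m≡ᵇ))
        (trivialPattern-sound (binAtomSymbol m) (binAtomArg₁ m) (binAtomArg₂ m) shape)

isTrivialAtom-complete : ∀ {m} → TrivialAtom m → T (isTrivialAtom m)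
isTrivialAtom-complete (eq-atom x) rewrite isTrivialAtom-binAtom 0 x x =
  Equivalence.from T-∨ (inj₁ (≡⇒≡ᵇ x x refl))
isTrivialAtom-complete (neq-atom {x} {y} x≢y) rewrite isTrivialAtom-binAtom 1 x y =
  ¬T⇒T-not (λ x≡ᵇy → x≢y (≡ᵇ⇒≡ x y x≡ᵇy))

data ProperAtom (τ : Vocab) : ℕ → Set where
  proper-atom : ∀ {i} → Valid τ i → 2 ≤ i → (js : Vec ℕ (arity τ i)) → ProperAtom τ (atom τ i js)

ProperAtom-symbol : ∀ {τ m} → ProperAtom τ m → 2 ≤ unpair₁ m
ProperAtom-symbol (proper-atom {i} _ 2≤i js) rewrite unpair₁-pair i (encVec js) = 2≤i

isValid : Maybe ℕ → ℕ → Bool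
isValid nothing  i = true
isValid (just k) i = suc i ≤ᵇ k

isValidᶜ : ∀ b → Computable n F → Computable n (λ xs → bit (isValid b (F xs)))
isValidᶜ nothing  f = constᶜ 1
isValidᶜ (just k) f = sucᶜ f ≤ᵇᶜ constᶜ k

isValid⇔Valid : ∀ b {i} → T (isValid b i) ⇔ ValidB b i
isValid⇔Valid nothing      = mk⇔ (λ _ → tt) (λ _ → tt)
isValid⇔Valid (just k) {i} = mk⇔ (≤ᵇ⇒≤ (suc i) k) ≤⇒≤ᵇ

module _ (τ : Vocab) where

  arityᶜ : Computable n F → Computable n (λ xs → arity τ (F xs))
  arityᶜ = compose₁ arityProgram
    where
    arityProgram : Computable 1 (λ xs → arity τ (lookup xs #0))
    arityProgram = record { program = arityProg τ ; computes = λ { (i ∷ []) → arityComp τ i } }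

  isProperAtom : ℕ → Bool
  isProperAtom m = isValid (bound τ) (unpair₁ m)
                 ∧ ((2 ≤ᵇ unpair₁ m) ∧ isTupleOfLength (arity τ (unpair₁ m)) (unpair₂ m))

  isProperAtomᶜ : Computable n F → Computable n (λ xs → bit (isProperAtom (F xs)))
  isProperAtomᶜ m =
    isValidᶜ (bound τ) (unpair₁ᶜ m)
    ∧ᶜ ((constᶜ 2 ≤ᵇᶜ unpair₁ᶜ m) ∧ᶜ isTupleOfLengthᶜ (arityᶜ (unpair₁ᶜ m)) (unpair₂ᶜ m))

  isProperAtom-sound : ∀ m → T (isProperAtom m) → ProperAtom τ m
  isProperAtom-sound m t with Equivalence.to T-∧ t
  ... | valid , t′ with Equivalence.to T-∧ t′
  ...   | 2≤i , tuple with isTupleOfLength-sound (arity τ (unpair₁ m)) (unpair₂ m) tuple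
  ...     | js , m₂≡js =
    subst (ProperAtom τ) (trans (cong (pair (unpair₁ m)) (sym m₂≡js)) (pair-unpair m))
          (proper-atom (Equivalence.to (isValid⇔Valid (bound τ)) valid) (≤ᵇ⇒≤ 2 _ 2≤i) js)

  isProperAtom-complete : ∀ {m} → ProperAtom τ m → T (isProperAtom m)
  isProperAtom-complete (proper-atom {i} valid 2≤i js)
    rewrite unpair₁-pair i (encVec js) | unpair₂-pair i (encVec js) =
    Equivalence.from T-∧ (Equivalence.from (isValid⇔Valid (bound τ)) valid ,
                          Equivalence.from T-∧ (≤⇒≤ᵇ 2≤i , isTupleOfLength-complete js))

module _ {τ : Vocab} where

  TrivialAtom⇒Diag : (S : Structure τ) → ∀ {m} → TrivialAtom m → Diag S m
  TrivialAtom⇒Diag S (eq-atom x) =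
    0 , eqValid τ , binTuple τ 0 (eqArity τ) x x , sym (atom-binTuple τ 0 (eqArity τ) x x) ,
    Equivalence.from (R-eq S x x) refl
  TrivialAtom⇒Diag S (neq-atom {x} {y} x≢y) =
    1 , neqValid τ , binTuple τ 1 (neqArity τ) x y , sym (atom-binTuple τ 1 (neqArity τ) x y) ,
    Equivalence.from (R-neq S x y) x≢y

  Diag⇒TrivialAtom⊎ProperAtom : (S : Structure τ) → ∀ {m} → Diag S m →
                                TrivialAtom m ⊎ ProperAtom τ m
  Diag⇒TrivialAtom⊎ProperAtom S (zero , _ , js , refl , r)
    with binTuple-surjective τ 0 (eqArity τ) js
  ... | x , y , refl with Equivalence.to (R-eq S x y) r
  ...   | refl = inj₁ (subst TrivialAtom (sym (atom-binTuple τ 0 (eqArity τ) x x)) (eq-atom x))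
  Diag⇒TrivialAtom⊎ProperAtom S (suc zero , _ , js , refl , r)
    with binTuple-surjective τ 1 (neqArity τ) js
  ... | x , y , refl = inj₁ (subst TrivialAtom (sym (atom-binTuple τ 1 (neqArity τ) x y))
                                    (neq-atom (Equivalence.to (R-neq S x y) r)))
  Diag⇒TrivialAtom⊎ProperAtom S (suc (suc i) , valid , js , refl , _) =
    inj₂ (proper-atom valid (s≤s (s≤s z≤n)) js)

  Mod-intro : ∀ {Y : SetN} → (∀ {m} → TrivialAtom m → Y m) →
              (∀ {m} → Y m → TrivialAtom m ⊎ ProperAtom τ m) → Mod τ Y
  Mod-intro {Y} trivial⊆Y Y⊆atoms = S , λ m → mk⇔ to (λ { (_ , _ , _ , refl , r) → r })
    where
    binAtom-inversion : ∀ {i x y} → i < 2 → Y (binAtom i x y) → (i ≡ 0 × x ≡ y) ⊎ (i ≡ 1 × x ≢ y)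
    binAtom-inversion {i} i<2 h with Y⊆atoms h
    ... | inj₁ t = TrivialAtom-inversion t refl
    ... | inj₂ p = ⊥-elim (<⇒≱ i<2 (subst (2 ≤_) (unpair₁-pair i _) (ProperAtom-symbol p)))

    eq-sound : ∀ {x y} → (0 ≡ 0 × x ≡ y) ⊎ (0 ≡ 1 × x ≢ y) → x ≡ y
    eq-sound (inj₁ (_ , x≡y)) = x≡y

    neq-sound : ∀ {x y} → (1 ≡ 0 × x ≡ y) ⊎ (1 ≡ 1 × x ≢ y) → x ≢ y
    neq-sound (inj₂ (_ , x≢y)) = x≢y

    S : Structure τ
    S = record
      { R     = λ i js → Y (atom τ i js)
      ; R-eq  = λ x y → mk⇔
          (λ h → eq-sound (binAtom-inversion (s≤s z≤n)
                             (subst Y (atom-binTuple τ 0 (eqArity τ) x y) h)))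
          (λ { refl → subst Y (sym (atom-binTuple τ 0 (eqArity τ) x x)) (trivial⊆Y (eq-atom x)) })
      ; R-neq = λ x y → mk⇔
          (λ h → neq-sound (binAtom-inversion (s≤s (s≤s z≤n))
                              (subst Y (atom-binTuple τ 1 (neqArity τ) x y) h)))
          (λ x≢y → subst Y (sym (atom-binTuple τ 1 (neqArity τ) x y)) (trivial⊆Y (neq-atom x≢y)))
      }

    to : ∀ {m} → Y m → Diag S m
    to h with Y⊆atoms h
    ... | inj₁ t = TrivialAtom⇒Diag S t
    ... | inj₂ (proper-atom {i} valid _ js) = i , valid , js , refl , h

Mod-resp-≐ : ∀ {τ X Y} → X ≐ Y → Mod τ Y → Mod τ X
Mod-resp-≐ X≐Y (S , Y≐DiagS) = S , λ n → Y≐DiagS n ⇔-∘ X≐Y n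

∉D0 : ∀ k → ¬ (k ∈D 0)
∉D0 zero    ()
∉D0 (suc k) h = ∉D0 k h

module _ (τ : Vocab) where

  -- D_0 = ∅, so a pair ⟨0 , m⟩ in W_a puts m into Γ_a(X) for every X.
  unconditional : ℕ → Bool
  unconditional p = (unpair₁ p ≡ᵇ 0) ∧ isTrivialAtom (unpair₂ p)

  unconditionalᶜ : Computable 1 (λ xs → bit (unconditional (lookup xs #0)))
  unconditionalᶜ = (unpair₁ᶜ (projᶜ #0) ≡ᵇᶜ constᶜ 0) ∧ᶜ isTrivialAtomᶜ (unpair₂ᶜ (projᶜ #0))

  properOutput : ℕ → Bool
  properOutput p = isProperAtom τ (unpair₂ p)

  properOutputᶜ : Computable 1 (λ xs → bit (properOutput (lookup xs #0)))
  properOutputᶜ = isProperAtomᶜ τ (unpair₂ᶜ (projᶜ #0))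

  totalize : Prog 1 → Prog 1
  totalize e =
    acceptorOr unconditional unconditionalᶜ (both e (acceptor properOutput properOutputᶜ))

  W-totalize : ∀ {e p} → W (totalize e) p ⇔ (T (unconditional p) ⊎ (W e p × T (properOutput p)))
  W-totalize {e} {p} = mk⇔ to from
    where
    to : W (totalize e) p → T (unconditional p) ⊎ (W e p × T (properOutput p))
    to = map₂ (λ w′ → Data.Product.map₂ (Equivalence.to (W-acceptor properOutput properOutputᶜ))
                                         (Equivalence.to W-both w′))
       ∘ Equivalence.to (W-acceptorOr unconditional unconditionalᶜ)
    from : T (unconditional p) ⊎ (W e p × T (properOutput p)) → W (totalize e) p
    from (inj₁ u)        = Equivalence.from (W-acceptorOr unconditional unconditionalᶜ) (inj₁ u)
    from (inj₂ (we , t)) = Equivalence.from (W-acceptorOr unconditional unconditionalᶜ) (inj₂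
      (Equivalence.from W-both (we , Equivalence.from (W-acceptor properOutput properOutputᶜ) t)))

  Γ-totalize : ∀ e X m → Γ (totalize e) X m ⇔ (TrivialAtom m ⊎ (ProperAtom τ m × Γ e X m))
  Γ-totalize e X m = mk⇔ to from
    where
    to : Γ (totalize e) X m → TrivialAtom m ⊎ (ProperAtom τ m × Γ e X m)
    to (v , w , D⊆X) = accepted (Equivalence.to W-totalize w)
      where
      accepted : T (unconditional (pair v m)) ⊎ (W e (pair v m) × T (properOutput (pair v m))) →
                 TrivialAtom m ⊎ (ProperAtom τ m × Γ e X m)
      accepted (inj₁ u) = inj₁ (isTrivialAtom-sound m
        (subst (T ∘ isTrivialAtom) (unpair₂-pair v m)
               (proj₂ (Equivalence.to (T-∧ {unpair₁ (pair v m) ≡ᵇ 0}) u))))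
      accepted (inj₂ (we , t)) =
        inj₂ (isProperAtom-sound τ m (subst (T ∘ isProperAtom τ) (unpair₂-pair v m) t) , v , we , D⊆X)
    from : TrivialAtom m ⊎ (ProperAtom τ m × Γ e X m) → Γ (totalize e) X m
    from (inj₁ t) = 0 , Equivalence.from W-totalize (inj₁ u) , λ k k∈D0 → ⊥-elim (∉D0 k k∈D0)
      where
      u : T (unconditional (pair 0 m))
      u rewrite unpair₁-pair 0 m | unpair₂-pair 0 m = isTrivialAtom-complete t
    from (inj₂ (p , v , we , D⊆X)) = v , Equivalence.from W-totalize (inj₂ (we , proper)) , D⊆X
      where
      proper : T (properOutput (pair v m))
      proper rewrite unpair₂-pair v m = isProperAtom-complete τ p

  Mod-Γ-totalize : ∀ e X → Mod τ (Γ (totalize e) X)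
  Mod-Γ-totalize e X = Mod-intro (λ {m} t → Equivalence.from (Γ-totalize e X m) (inj₁ t))
                                 (λ {m} h → map₂ proj₁ (Equivalence.to (Γ-totalize e X m) h))

  Γ-totalize-agrees : ∀ e X → Mod τ (Γ e X) → Γ (totalize e) X ≐ Γ e X
  Γ-totalize-agrees e X (S , Γe≐DiagS) m =
    mk⇔ (to ∘ Equivalence.to (Γ-totalize e X m))
        (Equivalence.from (Γ-totalize e X m) ∘ from)
    where
    to : TrivialAtom m ⊎ (ProperAtom τ m × Γ e X m) → Γ e X m
    to (inj₁ t)       = Equivalence.from (Γe≐DiagS m) (TrivialAtom⇒Diag S t)
    to (inj₂ (_ , h)) = h
    from : Γ e X m → TrivialAtom m ⊎ (ProperAtom τ m × Γ e X m)
    from h = map₂ (_, h) (Diag⇒TrivialAtom⊎ProperAtom S (Equivalence.to (Γe≐DiagS m) h))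

mainTheorem13 : (τ τ' : Vocab) (K K' : Class) → K ⊆Mod τ → K' ⊆Mod τ' →
    Σ (Prog 1 → Prog 1) λ f → ∀ e → IsCompEmb τ τ' K K' e →
      (∀ X → Mod τ X → Mod τ' (Γ (f e) X)) × SameImage K (f e) e
mainTheorem13 τ τ' K K' _ K'⊆Mod = totalize τ' , λ e (maps-into-K' , _) →
  (λ X _ → Mod-Γ-totalize τ' e X) ,
  (λ X X∈K → X , X∈K , agrees e maps-into-K' X X∈K) ,
  (λ Y Y∈K → Y , Y∈K , agrees e maps-into-K' Y Y∈K)
  where
  agrees : ∀ e → (∀ X → K X → Σ SetN λ Y → K' Y × (Γ e X ≐ Y)) →
           ∀ X → K X → Γ (totalize τ' e) X ≐ Γ e X
  agrees e maps-into-K' X X∈K with maps-into-K' X X∈K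
  ... | Y , Y∈K' , Γe≐Y = Γ-totalize-agrees τ' e X (Mod-resp-≐ Γe≐Y (K'⊆Mod Y Y∈K'))
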